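{- Let $k$ be an odd positive integer such that $5k+2$ is prime, and let $m$ be a positive integer. Then $$F_{5mk}+F_{3m}\equiv 0\pmod{5k+2}.$$
   Context: $(F_n)_{n\ge 0}$ denotes the Fibonacci sequence: $F_0=0$, $F_1=1$, $F_{n+2}=F_{n+1}+F_n$. -}

module Defs where

open import Data.Nat using (ℕ; zero; suc; _+_)

F : ℕ → ℕ
F zero = 0
F (suc zero) = 1
F (suc (suc n)) = F (suc n) + F n

-- Let p = 5k + 2; as k is odd, p ≡ 7 (mod 10). In the group ring ℤ[C₅] = ℤ[ζ]/(ζ⁵ - 1) modulo p,
-- the Gauss sum g = ζ - ζ² - ζ³ + ζ⁴ satisfies g³ = 5g, while the Frobenius x ↦ xᵖ maps g to
-- ζ² - ζ⁴ - ζ + ζ³ = -g because p ≡ 2 (mod 5); hence 5^((p-1)/2) ≡ -1 (mod p). In ℤ[φ] = ℤ[x]/(x² - x - 1)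
-- modulo p, where φⁿ⁺¹ = F(n) + F(n+1)φ, applying the Frobenius to √5 = 2φ - 1 then gives
-- F(p) ≡ -1 and F(p+1) ≡ 0, so that F(n + p + 1) ≡ -F(n). With d'Ocagne's identity this yields
-- F(a) ≡ -F(b) whenever a + b = m(p + 1) and b ≡ m (mod 2); take a = 5mk and b = 3m.
module Submission where

open import Algebra.Bundles using (CommutativeSemiring; CommutativeRing)
open import Algebra.Consequences.Propositional using (comm∧idˡ⇒id; comm∧idʳ⇒id; comm∧invˡ⇒inv; comm∧distrˡ⇒distrʳ)
open import Algebra.Definitions using (Congruent₁; Congruent₂)
open import Data.Fin using (Fin; zero; suc; toℕ; inject₁; fromℕ)
open import Data.Fin.Properties using (toℕ-inject₁; toℕ-fromℕ; toℕ<n)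
open import Data.Integer as ℤ using (ℤ; +_)
import Data.Integer.Properties as ℤₚ
open import Data.Integer.Tactic.RingSolver using () renaming (solve-∀ to solve-ℤ)
open import Data.Nat using (ℕ; zero; suc; _<_; _≤_; _∸_; z≤n; s≤s; _!; nonTrivial⇒n>1)
import Data.Nat as ℕ
open import Data.Nat.Combinatorics using (_C_; nCn≡1; k![n∸k]!∣n!; nCk≡n!/k![n-k]!)
open import Data.Nat.DivMod using (_/_; m*[n/m]≡n; m≡m%n+[m/n]*n)
open import Data.Nat.Divisibility using (_∣_; _∤_; divides; ∣⇒≤; m∣m*n)
open import Data.Nat.Primality using (Prime; euclidsLemma; prime⇒nonTrivial)
open import Data.Nat.Properties using (_!*_!≢0; <⇒≱; <⇒≤; <-trans; n<1+n; ∸-monoʳ-<; n∸n≡0)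
import Data.Nat.Properties as ℕₚ
open import Data.Nat.Tactic.RingSolver using () renaming (solve-∀ to solve-ℕ)
open import Data.Product using (_,_)
open import Data.Sum using (inj₁; inj₂)
open import Data.Vec.Functional using (Vector)
open import Level using (0ℓ; _⊔_)
open import Relation.Binary using (Symmetric; Transitive; IsEquivalence)
open import Relation.Binary.PropositionalEquality as ≡ using (_≡_)
open import Relation.Nullary using (contradiction)
open import Defs

-- Powers and the Frobenius endomorphism in commutative semirings

module CommutativeSemiringProperties {a ℓ} (S : CommutativeSemiring a ℓ) where

  open CommutativeSemiring S
  open import Algebra.Properties.Semiring.Exp semiring using (_^_; ^-congˡ; ^-homo-*; ^-assocʳ)
  open import Algebra.Properties.CommutativeSemigroup *-commutativeSemigroup using (x∙yz≈y∙xz)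
  open import Relation.Binary.Reasoning.Setoid setoid

  1^n≈1 : ∀ n → 1# ^ n ≈ 1#
  1^n≈1 zero    = refl
  1^n≈1 (suc n) = trans (*-identityˡ _) (1^n≈1 n)

  ^-periodic : ∀ {x m} → x ^ m ≈ 1# → ∀ r k → x ^ (r ℕ.+ m ℕ.* k) ≈ x ^ r
  ^-periodic {x} {m} x^m≈1 r k = begin
    x ^ (r ℕ.+ m ℕ.* k)    ≈⟨ ^-homo-* x r (m ℕ.* k) ⟩
    x ^ r * x ^ (m ℕ.* k)  ≈⟨ *-congˡ (^-assocʳ x m k) ⟨
    x ^ r * (x ^ m) ^ k    ≈⟨ *-congˡ (^-congˡ k x^m≈1) ⟩
    x ^ r * 1# ^ k         ≈⟨ *-congˡ (1^n≈1 k) ⟩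
    x ^ r * 1#             ≈⟨ *-identityʳ _ ⟩
    x ^ r                  ∎

  ^-odd : ∀ {x y} → x * (x * x) ≈ y * x → ∀ k → x ^ suc (2 ℕ.* k) ≈ y ^ k * x
  ^-odd {x} {y} x³≈yx zero    = trans (*-identityʳ x) (sym (*-identityˡ x))
  ^-odd {x} {y} x³≈yx (suc k) = begin
    x ^ suc (2 ℕ.* suc k)        ≡⟨ ≡.cong (λ n → x ^ suc n) (ℕₚ.*-suc 2 k) ⟩
    x * (x * x ^ suc (2 ℕ.* k))  ≈⟨ *-congˡ (*-congˡ (^-odd x³≈yx k)) ⟩
    x * (x * (y ^ k * x))        ≈⟨ *-congˡ (x∙yz≈y∙xz x (y ^ k) x) ⟩
    x * (y ^ k * (x * x))        ≈⟨ x∙yz≈y∙xz x (y ^ k) (x * x) ⟩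
    y ^ k * (x * (x * x))        ≈⟨ *-congˡ x³≈yx ⟩
    y ^ k * (y * x)              ≈⟨ x∙yz≈y∙xz (y ^ k) y x ⟩
    y * (y ^ k * x)              ≈⟨ *-assoc y (y ^ k) x ⟨
    y ^ suc k * x                ∎

  *-cancelˡ-unit : ∀ {h c x y} → h * c ≈ 1# → c * x ≈ c * y → x ≈ y
  *-cancelˡ-unit {h} {c} {x} {y} hc≈1 cx≈cy = begin
    x              ≈⟨ *-identityˡ x ⟨
    1# * x         ≈⟨ *-congʳ hc≈1 ⟨
    (h * c) * x    ≈⟨ *-assoc h c x ⟩
    h * (c * x)    ≈⟨ *-congˡ cx≈cy ⟩
    h * (c * y)    ≈⟨ *-assoc h c y ⟨
    (h * c) * y    ≈⟨ *-congʳ hc≈1 ⟩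
    1# * y         ≈⟨ *-identityˡ y ⟩
    y              ∎

module _ where

  open import Data.Nat using (_*_)

  m<p⇒p∤m! : ∀ {p} → Prime p → ∀ m → m < p → p ∤ m !
  m<p⇒p∤m! p-prime zero    _   p∣1  = <⇒≱ (nonTrivial⇒n>1 _ {{prime⇒nonTrivial p-prime}}) (∣⇒≤ p∣1)
  m<p⇒p∤m! p-prime (suc m) m<p p∣m! with euclidsLemma (suc m) (m !) p-prime p∣m!
  ... | inj₁ p∣1+m = <⇒≱ m<p (∣⇒≤ p∣1+m)
  ... | inj₂ p∣m!′ = m<p⇒p∤m! p-prime m (<-trans (n<1+n m) m<p) p∣m!′

  k![n∸k]!*nCk≡n! : ∀ {n k} → k ≤ n → k ! * (n ∸ k) ! * (n C k) ≡ n !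
  k![n∸k]!*nCk≡n! {n} {k} k≤n =
    ≡.trans (≡.cong (k ! * (n ∸ k) ! *_) (nCk≡n!/k![n-k]! k≤n)) (m*[n/m]≡n (k![n∸k]!∣n! k≤n))
    where instance _ = k !* (n ∸ k) !≢0

  p∣pCk : ∀ {p k} → Prime p → 0 < k → k < p → p ∣ p C k
  p∣pCk {p@(suc q)} {k} p-prime 0<k k<p
    with euclidsLemma (k ! * (p ∸ k) !) (p C k) p-prime
           (≡.subst (p ∣_) (≡.sym (k![n∸k]!*nCk≡n! (<⇒≤ k<p))) (m∣m*n (q !)))
  ... | inj₂ p∣pCk = p∣pCk
  ... | inj₁ p∣k![p∸k]! with euclidsLemma (k !) ((p ∸ k) !) p-prime p∣k![p∸k]!
  ...   | inj₁ p∣k!     = contradiction p∣k! (m<p⇒p∤m! p-prime k k<p)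
  ...   | inj₂ p∣[p∸k]! = contradiction p∣[p∸k]! (m<p⇒p∤m! p-prime (p ∸ k) (∸-monoʳ-< 0<k (<⇒≤ k<p)))

module Frobenius {a ℓ} (S : CommutativeSemiring a ℓ) where

  open CommutativeSemiring S hiding (zero)
  open import Algebra.Properties.Semiring.Mult semiring using (_×_; ×-assocˡ)
  open import Algebra.Properties.Semiring.Exp semiring using (_^_)
  open import Algebra.Properties.Monoid.Sum +-monoid using (sum; sum-cong-≋; sum-replicate-zero; sum-init-last)
  open import Algebra.Properties.CommutativeSemiring.Binomial S using (theorem; binomialTerm)
  open import Data.Vec.Functional using (replicate; tail; init)
  open import Relation.Binary.Reasoning.Setoid setoid

  ∣⇒×≈0 : ∀ {p n} → (∀ x → p × x ≈ 0#) → p ∣ n → ∀ x → n × x ≈ 0#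
  ∣⇒×≈0 {p} char (divides q ≡.refl) x = begin
    (q ℕ.* p) × x  ≡⟨ ≡.cong (_× x) (ℕₚ.*-comm q p) ⟩
    (p ℕ.* q) × x  ≈⟨ ×-assocˡ x p q ⟨
    p × (q × x)    ≈⟨ char (q × x) ⟩
    0#             ∎

  frobenius : ∀ {p} → Prime p → (∀ x → p × x ≈ 0#) → ∀ x y → (x + y) ^ p ≈ x ^ p + y ^ p
  frobenius {suc q} p-prime char x y = begin
    (x + y) ^ suc q                                     ≈⟨ theorem (suc q) x y ⟩
    t zero + sum (tail t)                               ≈⟨ +-congˡ (sum-init-last (tail t)) ⟩
    t zero + (sum (init (tail t)) + t (fromℕ (suc q)))  ≈⟨ +-congˡ (+-congʳ (sum-cong-≋ middle)) ⟩
    t zero + (sum (replicate q 0#) + t (fromℕ (suc q))) ≈⟨ +-congˡ (+-congʳ (sum-replicate-zero q)) ⟩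
    t zero + (0# + t (fromℕ (suc q)))                   ≈⟨ +-cong first (trans (+-identityˡ _) last) ⟩
    y ^ suc q + x ^ suc q                               ≈⟨ +-comm _ _ ⟩
    x ^ suc q + y ^ suc q                               ∎
    where
    t : Fin (suc (suc q)) → Carrier
    t = binomialTerm x y (suc q)
    middle : ∀ (i : Fin q) → t (suc (inject₁ i)) ≈ 0#
    middle i = ∣⇒×≈0 char (p∣pCk p-prime (s≤s z≤n)
                 (s≤s (≡.subst (_< q) (≡.sym (toℕ-inject₁ i)) (toℕ<n i)))) _
    first : t zero ≈ y ^ suc q
    first = trans (+-identityʳ _) (*-identityˡ _)
    last : t (fromℕ (suc q)) ≈ x ^ suc q
    last = begin
      (suc q C toℕ (fromℕ (suc q))) × (x ^ toℕ (fromℕ (suc q)) * y ^ (suc q ∸ toℕ (fromℕ (suc q))))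
        ≡⟨ ≡.cong (λ r → (suc q C r) × (x ^ r * y ^ (suc q ∸ r))) (toℕ-fromℕ (suc q)) ⟩
      (suc q C suc q) × (x ^ suc q * y ^ (q ∸ q))
        ≡⟨ ≡.cong₂ (λ c r → c × (x ^ suc q * y ^ r)) (nCn≡1 (suc q)) (n∸n≡0 q) ⟩
      x ^ suc q * 1# + 0#   ≈⟨ +-identityʳ _ ⟩
      x ^ suc q * 1#        ≈⟨ *-identityʳ _ ⟩
      x ^ suc q             ∎

  frobenius-sum : ∀ {p} → Prime p → (∀ x → p × x ≈ 0#) → ∀ {n} (xs : Vector Carrier n) →
                  sum xs ^ p ≈ sum (λ i → xs i ^ p)
  frobenius-sum {suc q} p-prime char {zero}  xs = zeroˡ (0# ^ q)
  frobenius-sum {suc q} p-prime char {suc n} xs = begin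
    (xs zero + sum (tail xs)) ^ suc q                ≈⟨ frobenius p-prime char (xs zero) (sum (tail xs)) ⟩
    xs zero ^ suc q + sum (tail xs) ^ suc q          ≈⟨ +-congˡ (frobenius-sum p-prime char (tail xs)) ⟩
    xs zero ^ suc q + sum (λ i → tail xs i ^ suc q)  ∎

-- Rings modulo a principal ideal

module Quotient {c ℓ} (R : CommutativeRing c ℓ) (P : CommutativeRing.Carrier R) where

  open CommutativeRing R
  open import Algebra.Properties.Ring ring using (-‿distribˡ-*)
  open import Algebra.Properties.AbelianGroup +-abelianGroup using (⁻¹-∙-comm)
  open import Algebra.Properties.CommutativeSemigroup +-commutativeSemigroup using (interchange)
  open import Algebra.Properties.CommutativeSemigroup *-commutativeSemigroup using (xy∙z≈xz∙y)
  open import Relation.Binary.Reasoning.Setoid setoid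

  infix 4 _≋_
  record _≋_ (x y : Carrier) : Set (c ⊔ ℓ) where
    field
      multiplier : Carrier
      difference : x ≈ y + multiplier * P

  open _≋_

  private
    *P-distrib : ∀ z z′ → z * P + z′ * P ≈ (z + z′) * P
    *P-distrib z z′ = sym (distribʳ P z z′)

  ≈⇒≋ : ∀ {x y} → x ≈ y → x ≋ y
  ≈⇒≋ {x} {y} x≈y = record { multiplier = 0# ; difference = begin
    x            ≈⟨ x≈y ⟩
    y            ≈⟨ +-identityʳ y ⟨
    y + 0#       ≈⟨ +-congˡ (zeroˡ P) ⟨
    y + 0# * P   ∎ }

  ≋-sym : Symmetric _≋_
  ≋-sym {x} {y} x≋y = record { multiplier = - z ; difference = begin
    y                         ≈⟨ +-identityʳ y ⟨
    y + 0#                    ≈⟨ +-congˡ (zeroˡ P) ⟨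
    y + 0# * P                ≈⟨ +-congˡ (*-congʳ (-‿inverseʳ z)) ⟨
    y + (z - z) * P           ≈⟨ +-congˡ (*P-distrib z (- z)) ⟨
    y + (z * P + - z * P)     ≈⟨ +-assoc y _ _ ⟨
    (y + z * P) + - z * P     ≈⟨ +-congʳ (difference x≋y) ⟨
    x + - z * P               ∎ }
    where
    z : Carrier
    z = multiplier x≋y

  ≋-trans : Transitive _≋_
  ≋-trans {x} {y} {w} x≋y y≋w = record { multiplier = z′ + z ; difference = begin
    x                         ≈⟨ difference x≋y ⟩
    y + z * P                 ≈⟨ +-congʳ (difference y≋w) ⟩
    (w + z′ * P) + z * P      ≈⟨ +-assoc w _ _ ⟩
    w + (z′ * P + z * P)      ≈⟨ +-congˡ (*P-distrib z′ z) ⟩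
    w + (z′ + z) * P          ∎ }
    where
    z z′ : Carrier
    z = multiplier x≋y
    z′ = multiplier y≋w

  ≋-isEquivalence : IsEquivalence _≋_
  ≋-isEquivalence = record { refl = ≈⇒≋ refl ; sym = ≋-sym ; trans = ≋-trans }

  +-cong-≋ : Congruent₂ _≋_ _+_
  +-cong-≋ {x} {y} {u} {v} x≋y u≋v = record { multiplier = z + z′ ; difference = begin
    x + u                       ≈⟨ +-cong (difference x≋y) (difference u≋v) ⟩
    (y + z * P) + (v + z′ * P)  ≈⟨ interchange y _ v _ ⟩
    (y + v) + (z * P + z′ * P)  ≈⟨ +-congˡ (*P-distrib z z′) ⟩
    (y + v) + (z + z′) * P      ∎ }
    where
    z z′ : Carrier
    z = multiplier x≋y
    z′ = multiplier u≋v

  *-cong-≋ : Congruent₂ _≋_ _*_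
  *-cong-≋ {x} {y} {u} {v} x≋y u≋v = record { multiplier = y * z′ + z * w ; difference = begin
    x * u                             ≈⟨ *-cong (difference x≋y) (difference u≋v) ⟩
    (y + z * P) * w                   ≈⟨ distribʳ w y (z * P) ⟩
    y * w + (z * P) * w               ≈⟨ +-congʳ (distribˡ y v (z′ * P)) ⟩
    (y * v + y * (z′ * P)) + (z * P) * w
                                      ≈⟨ +-assoc (y * v) _ _ ⟩
    y * v + (y * (z′ * P) + (z * P) * w)
                                      ≈⟨ +-congˡ (+-cong (*-assoc y z′ P) (xy∙z≈xz∙y z w P)) ⟨
    y * v + ((y * z′) * P + (z * w) * P)
                                      ≈⟨ +-congˡ (*P-distrib _ _) ⟩
    y * v + (y * z′ + z * w) * P      ∎ }
    where
    z z′ w : Carrier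
    z = multiplier x≋y
    z′ = multiplier u≋v
    w = v + z′ * P

  -‿cong-≋ : Congruent₁ _≋_ (-_)
  -‿cong-≋ {x} {y} x≋y = record { multiplier = - z ; difference = begin
    - x               ≈⟨ -‿cong (difference x≋y) ⟩
    - (y + z * P)     ≈⟨ ⁻¹-∙-comm y (z * P) ⟨
    - y + - (z * P)   ≈⟨ +-congˡ (-‿distribˡ-* z P) ⟩
    - y + - z * P     ∎ }
    where
    z : Carrier
    z = multiplier x≋y

  quotientRing : CommutativeRing c (c ⊔ ℓ)
  quotientRing = record
    { _≈_ = _≋_
    ; isCommutativeRing = record
      { isRing = record
        { +-isAbelianGroup = record
          { isGroup = record
            { isMonoid = record
              { isSemigroup = record
                { isMagma = record { isEquivalence = ≋-isEquivalence ; ∙-cong = +-cong-≋ }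
                ; assoc = λ x y z → ≈⇒≋ (+-assoc x y z) }
              ; identity = (λ x → ≈⇒≋ (+-identityˡ x)) , (λ x → ≈⇒≋ (+-identityʳ x)) }
            ; inverse = (λ x → ≈⇒≋ (-‿inverseˡ x)) , (λ x → ≈⇒≋ (-‿inverseʳ x))
            ; ⁻¹-cong = -‿cong-≋ }
          ; comm = λ x y → ≈⇒≋ (+-comm x y) }
        ; *-cong = *-cong-≋
        ; *-assoc = λ x y z → ≈⇒≋ (*-assoc x y z)
        ; *-identity = (λ x → ≈⇒≋ (*-identityˡ x)) , (λ x → ≈⇒≋ (*-identityʳ x))
        ; distrib = (λ x y z → ≈⇒≋ (distribˡ x y z)) , (λ x y z → ≈⇒≋ (distribʳ x y z)) }
      ; *-comm = λ x y → ≈⇒≋ (*-comm x y) } }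

  open import Algebra.Properties.Semiring.Mult semiring using (_×_; ×-comm-*; ×-congʳ)
  private
    module R/P = CommutativeRing quotientRing
  open import Algebra.Properties.Semiring.Mult R/P.semiring using () renaming (_×_ to _×≋_)

  ×≋≡× : ∀ n x → n ×≋ x ≡ n × x
  ×≋≡× zero    x = ≡.refl
  ×≋≡× (suc n) x = ≡.cong (_+_ x) (×≋≡× n x)

  characteristic : ∀ {n} → P ≈ n × 1# → ∀ x → n ×≋ x ≋ 0#
  characteristic {n} P≈n×1 x = record { multiplier = x ; difference = begin
    n ×≋ x         ≡⟨ ×≋≡× n x ⟩
    n × x          ≈⟨ ×-congʳ n (*-identityʳ x) ⟨
    n × (x * 1#)   ≈⟨ ×-comm-* n x 1# ⟨
    x * (n × 1#)   ≈⟨ *-congˡ P≈n×1 ⟨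
    x * P          ≈⟨ +-identityˡ (x * P) ⟨
    0# + x * P     ∎ }

module _ {a ℓ b ℓ′} {R : CommutativeRing a ℓ} {S : CommutativeRing b ℓ′}
         {P : CommutativeRing.Carrier R} {P′ : CommutativeRing.Carrier S} where

  private
    module R = CommutativeRing R
    module S = CommutativeRing S

  open import Relation.Binary.Reasoning.Setoid S.setoid

  ≋-map : (f : R.Carrier → S.Carrier) → (∀ {x y} → x R.≈ y → f x S.≈ f y) →
          (∀ x y → f (x R.+ y) S.≈ f x S.+ f y) → (∀ z → f (z R.* P) S.≈ f z S.* P′) →
          ∀ {x y} → Quotient._≋_ R P x y → Quotient._≋_ S P′ (f x) (f y)
  ≋-map f f-cong f-+ f-*P {x} {y} x≋y = record { multiplier = f z ; difference = begin
    f x                  ≈⟨ f-cong difference ⟩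
    f (y R.+ z R.* P)    ≈⟨ f-+ y (z R.* P) ⟩
    f y S.+ f (z R.* P)  ≈⟨ S.+-congˡ (f-*P z) ⟩
    f y S.+ f z S.* P′   ∎ }
    where
    open Quotient._≋_ x≋y
    z : R.Carrier
    z = multiplier

ℤ/_ : ℕ → CommutativeRing 0ℓ 0ℓ
ℤ/ q = Quotient.quotientRing ℤₚ.+-*-commutativeRing (+ q)

infix 4 _≡_mod_
_≡_mod_ : ℤ → ℤ → ℕ → Set
_≡_mod_ x y q = CommutativeRing._≈_ (ℤ/ q) x y

≡0-mod⇒∣ : ∀ {q n} → + n ≡ + 0 mod q → q ∣ n
≡0-mod⇒∣ {q} {n} n≡0 = divides ℤ.∣ multiplier ∣ (begin
  n                                 ≡⟨⟩
  ℤ.∣ + n ∣                         ≡⟨ ≡.cong ℤ.∣_∣ difference ⟩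
  ℤ.∣ + 0 ℤ.+ multiplier ℤ.* + q ∣  ≡⟨ ≡.cong ℤ.∣_∣ (ℤₚ.+-identityˡ (multiplier ℤ.* + q)) ⟩
  ℤ.∣ multiplier ℤ.* + q ∣          ≡⟨ ℤₚ.abs-* multiplier (+ q) ⟩
  ℤ.∣ multiplier ∣ ℕ.* q            ∎)
  where
  open Quotient._≋_ n≡0
  open ≡.≡-Reasoning

-- The group ring ℤ[C₅] and the ring ℤ[φ]

module ℤ[C₅] where

  open import Data.Integer using (_+_; _*_; -_)
  open ≡ using (refl; trans; cong; cong₂)

  -- ⟨ a₀ , a₁ , a₂ , a₃ , a₄ ⟩ stands for a₀ + a₁ζ + a₂ζ² + a₃ζ³ + a₄ζ⁴, where ζ⁵ = 1.
  record ℤ[C₅] : Set where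
    constructor ⟨_,_,_,_,_⟩
    field c₀ c₁ c₂ c₃ c₄ : ℤ

  open ℤ[C₅] public

  ⟨⟩-cong : ∀ {a₀ a₁ a₂ a₃ a₄ b₀ b₁ b₂ b₃ b₄} →
            a₀ ≡ b₀ → a₁ ≡ b₁ → a₂ ≡ b₂ → a₃ ≡ b₃ → a₄ ≡ b₄ →
            ⟨ a₀ , a₁ , a₂ , a₃ , a₄ ⟩ ≡ ⟨ b₀ , b₁ , b₂ , b₃ , b₄ ⟩
  ⟨⟩-cong refl refl refl refl refl = refl

  ι : ℤ → ℤ[C₅]
  ι c = ⟨ c , + 0 , + 0 , + 0 , + 0 ⟩

  ζ : ℤ[C₅]
  ζ = ⟨ + 0 , + 1 , + 0 , + 0 , + 0 ⟩

  infixl 6 _⊕_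
  infixl 7 _⊗_ _⊙_
  infix  8 ⊖_

  _⊕_ : ℤ[C₅] → ℤ[C₅] → ℤ[C₅]
  ⟨ a₀ , a₁ , a₂ , a₃ , a₄ ⟩ ⊕ ⟨ b₀ , b₁ , b₂ , b₃ , b₄ ⟩ = ⟨ a₀ + b₀ , a₁ + b₁ , a₂ + b₂ , a₃ + b₃ , a₄ + b₄ ⟩

  ⊖_ : ℤ[C₅] → ℤ[C₅]
  ⊖ ⟨ a₀ , a₁ , a₂ , a₃ , a₄ ⟩ = ⟨ - a₀ , - a₁ , - a₂ , - a₃ , - a₄ ⟩

  rotate : ℤ[C₅] → ℤ[C₅]
  rotate ⟨ a₀ , a₁ , a₂ , a₃ , a₄ ⟩ = ⟨ a₁ , a₂ , a₃ , a₄ , a₀ ⟩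

  infixr 8 _↻_
  _↻_ : ℕ → ℤ[C₅] → ℤ[C₅]
  zero  ↻ a = a
  suc k ↻ a = rotate (k ↻ a)

  -- a ⊙ b is the coefficient of ζ⁰ in a ⊗ b; as rotate a = ζ⁻¹a, the coefficient of ζᵏ is (k ↻ a) ⊙ b.
  _⊙_ : ℤ[C₅] → ℤ[C₅] → ℤ
  ⟨ a₀ , a₁ , a₂ , a₃ , a₄ ⟩ ⊙ ⟨ b₀ , b₁ , b₂ , b₃ , b₄ ⟩ = a₀ * b₀ + a₁ * b₄ + a₂ * b₃ + a₃ * b₂ + a₄ * b₁

  _⊗_ : ℤ[C₅] → ℤ[C₅] → ℤ[C₅]
  a ⊗ b = ⟨ a ⊙ b , 1 ↻ a ⊙ b , 2 ↻ a ⊙ b , 3 ↻ a ⊙ b , 4 ↻ a ⊙ b ⟩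

  ↻-rotate : ∀ k a → k ↻ rotate a ≡ rotate (k ↻ a)
  ↻-rotate zero    a = refl
  ↻-rotate (suc k) a = cong rotate (↻-rotate k a)

  ↻-⊗ : ∀ k a b → k ↻ (a ⊗ b) ≡ (k ↻ a) ⊗ b
  ↻-⊗ zero    a b = refl
  ↻-⊗ (suc k) a b = cong rotate (↻-⊗ k a b)

  ⊙-comm : ∀ a b → a ⊙ b ≡ b ⊙ a
  ⊙-comm ⟨ x₀ , x₁ , x₂ , x₃ , x₄ ⟩ ⟨ y₀ , y₁ , y₂ , y₃ , y₄ ⟩ = polynomial x₀ x₁ x₂ x₃ x₄ y₀ y₁ y₂ y₃ y₄
    where
    polynomial : ∀ x₀ x₁ x₂ x₃ x₄ y₀ y₁ y₂ y₃ y₄ →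
      x₀ * y₀ + x₁ * y₄ + x₂ * y₃ + x₃ * y₂ + x₄ * y₁
        ≡ y₀ * x₀ + y₁ * x₄ + y₂ * x₃ + y₃ * x₂ + y₄ * x₁
    polynomial = solve-ℤ

  ⊙-rotate : ∀ a b → rotate a ⊙ b ≡ a ⊙ rotate b
  ⊙-rotate ⟨ x₀ , x₁ , x₂ , x₃ , x₄ ⟩ ⟨ y₀ , y₁ , y₂ , y₃ , y₄ ⟩ = polynomial x₀ x₁ x₂ x₃ x₄ y₀ y₁ y₂ y₃ y₄
    where
    polynomial : ∀ x₀ x₁ x₂ x₃ x₄ y₀ y₁ y₂ y₃ y₄ →
      x₁ * y₀ + x₂ * y₄ + x₃ * y₃ + x₄ * y₂ + x₀ * y₁
        ≡ x₀ * y₁ + x₁ * y₀ + x₂ * y₄ + x₃ * y₃ + x₄ * y₂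
    polynomial = solve-ℤ

  ⊙-distribˡ : ∀ a b c → a ⊙ (b ⊕ c) ≡ a ⊙ b + a ⊙ c
  ⊙-distribˡ ⟨ x₀ , x₁ , x₂ , x₃ , x₄ ⟩ ⟨ y₀ , y₁ , y₂ , y₃ , y₄ ⟩ ⟨ z₀ , z₁ , z₂ , z₃ , z₄ ⟩ =
    polynomial x₀ x₁ x₂ x₃ x₄ y₀ y₁ y₂ y₃ y₄ z₀ z₁ z₂ z₃ z₄
    where
    polynomial : ∀ x₀ x₁ x₂ x₃ x₄ y₀ y₁ y₂ y₃ y₄ z₀ z₁ z₂ z₃ z₄ →
      x₀ * (y₀ + z₀) + x₁ * (y₄ + z₄) + x₂ * (y₃ + z₃) + x₃ * (y₂ + z₂) + x₄ * (y₁ + z₁)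
        ≡ x₀ * y₀ + x₁ * y₄ + x₂ * y₃ + x₃ * y₂ + x₄ * y₁ + (x₀ * z₀ + x₁ * z₄ + x₂ * z₃ + x₃ * z₂ + x₄ * z₁)
    polynomial = solve-ℤ

  ⊙-ι : ∀ a s → a ⊙ ι s ≡ c₀ a * s
  ⊙-ι ⟨ x₀ , x₁ , x₂ , x₃ , x₄ ⟩ s = polynomial x₀ x₁ x₂ x₃ x₄ s
    where
    polynomial : ∀ x₀ x₁ x₂ x₃ x₄ s →
      x₀ * s + x₁ * (+ 0) + x₂ * (+ 0) + x₃ * (+ 0) + x₄ * (+ 0)
        ≡ x₀ * s
    polynomial = solve-ℤ

  ⊙-assoc : ∀ a b c → (a ⊗ b) ⊙ c ≡ a ⊙ (b ⊗ c)
  ⊙-assoc ⟨ x₀ , x₁ , x₂ , x₃ , x₄ ⟩ ⟨ y₀ , y₁ , y₂ , y₃ , y₄ ⟩ ⟨ z₀ , z₁ , z₂ , z₃ , z₄ ⟩ =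
    polynomial x₀ x₁ x₂ x₃ x₄ y₀ y₁ y₂ y₃ y₄ z₀ z₁ z₂ z₃ z₄
    where
    polynomial : ∀ x₀ x₁ x₂ x₃ x₄ y₀ y₁ y₂ y₃ y₄ z₀ z₁ z₂ z₃ z₄ →
      (x₀ * y₀ + x₁ * y₄ + x₂ * y₃ + x₃ * y₂ + x₄ * y₁) * z₀
      + (x₁ * y₀ + x₂ * y₄ + x₃ * y₃ + x₄ * y₂ + x₀ * y₁) * z₄
      + (x₂ * y₀ + x₃ * y₄ + x₄ * y₃ + x₀ * y₂ + x₁ * y₁) * z₃
      + (x₃ * y₀ + x₄ * y₄ + x₀ * y₃ + x₁ * y₂ + x₂ * y₁) * z₂
      + (x₄ * y₀ + x₀ * y₄ + x₁ * y₃ + x₂ * y₂ + x₃ * y₁) * z₁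
        ≡ x₀ * (y₀ * z₀ + y₁ * z₄ + y₂ * z₃ + y₃ * z₂ + y₄ * z₁)
        + x₁ * (y₄ * z₀ + y₀ * z₄ + y₁ * z₃ + y₂ * z₂ + y₃ * z₁)
        + x₂ * (y₃ * z₀ + y₄ * z₄ + y₀ * z₃ + y₁ * z₂ + y₂ * z₁)
        + x₃ * (y₂ * z₀ + y₃ * z₄ + y₄ * z₃ + y₀ * z₂ + y₁ * z₁)
        + x₄ * (y₁ * z₀ + y₂ * z₄ + y₃ * z₃ + y₄ * z₂ + y₀ * z₁)
    polynomial = solve-ℤ

  ⊙-↻ : ∀ k a b → k ↻ a ⊙ b ≡ a ⊙ k ↻ b
  ⊙-↻ zero    a b = refl
  ⊙-↻ (suc k) a b = begin
    rotate (k ↻ a) ⊙ b   ≡⟨ ⊙-rotate (k ↻ a) b ⟩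
    k ↻ a ⊙ rotate b     ≡⟨ ⊙-↻ k a (rotate b) ⟩
    a ⊙ k ↻ rotate b     ≡⟨ cong (a ⊙_) (↻-rotate k b) ⟩
    a ⊙ rotate (k ↻ b)   ∎
    where open ≡.≡-Reasoning

  ⊗-comm : ∀ a b → a ⊗ b ≡ b ⊗ a
  ⊗-comm a b = ⟨⟩-cong (comm 0) (comm 1) (comm 2) (comm 3) (comm 4)
    where
    comm : ∀ k → k ↻ a ⊙ b ≡ k ↻ b ⊙ a
    comm k = trans (⊙-↻ k a b) (⊙-comm a (k ↻ b))

  ⊗-assoc : ∀ a b c → (a ⊗ b) ⊗ c ≡ a ⊗ (b ⊗ c)
  ⊗-assoc a b c = ⟨⟩-cong (assoc 0) (assoc 1) (assoc 2) (assoc 3) (assoc 4)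
    where
    assoc : ∀ k → k ↻ (a ⊗ b) ⊙ c ≡ k ↻ a ⊙ (b ⊗ c)
    assoc k = trans (cong (_⊙ c) (↻-⊗ k a b)) (⊙-assoc (k ↻ a) b c)

  ⊗-distribˡ : ∀ a b c → a ⊗ (b ⊕ c) ≡ a ⊗ b ⊕ a ⊗ c
  ⊗-distribˡ a b c = ⟨⟩-cong (⊙-distribˡ a b c) (⊙-distribˡ (1 ↻ a) b c) (⊙-distribˡ (2 ↻ a) b c)
                             (⊙-distribˡ (3 ↻ a) b c) (⊙-distribˡ (4 ↻ a) b c)

  ⊗-ι : ∀ a s → a ⊗ ι s ≡ ⟨ c₀ a * s , c₁ a * s , c₂ a * s , c₃ a * s , c₄ a * s ⟩
  ⊗-ι a s = ⟨⟩-cong (⊙-ι a s) (⊙-ι (1 ↻ a) s) (⊙-ι (2 ↻ a) s) (⊙-ι (3 ↻ a) s) (⊙-ι (4 ↻ a) s)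

  ⊕-assoc : ∀ a b c → (a ⊕ b) ⊕ c ≡ a ⊕ (b ⊕ c)
  ⊕-assoc a b c = ⟨⟩-cong (ℤₚ.+-assoc (c₀ a) _ _) (ℤₚ.+-assoc (c₁ a) _ _) (ℤₚ.+-assoc (c₂ a) _ _)
                          (ℤₚ.+-assoc (c₃ a) _ _) (ℤₚ.+-assoc (c₄ a) _ _)

  ⊕-comm : ∀ a b → a ⊕ b ≡ b ⊕ a
  ⊕-comm a b = ⟨⟩-cong (ℤₚ.+-comm (c₀ a) _) (ℤₚ.+-comm (c₁ a) _) (ℤₚ.+-comm (c₂ a) _)
                       (ℤₚ.+-comm (c₃ a) _) (ℤₚ.+-comm (c₄ a) _)

  ⊕-identityˡ : ∀ a → ι (+ 0) ⊕ a ≡ a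
  ⊕-identityˡ a = ⟨⟩-cong (ℤₚ.+-identityˡ (c₀ a)) (ℤₚ.+-identityˡ (c₁ a)) (ℤₚ.+-identityˡ (c₂ a))
                          (ℤₚ.+-identityˡ (c₃ a)) (ℤₚ.+-identityˡ (c₄ a))

  ⊖-inverseˡ : ∀ a → ⊖ a ⊕ a ≡ ι (+ 0)
  ⊖-inverseˡ a = ⟨⟩-cong (ℤₚ.+-inverseˡ (c₀ a)) (ℤₚ.+-inverseˡ (c₁ a)) (ℤₚ.+-inverseˡ (c₂ a))
                         (ℤₚ.+-inverseˡ (c₃ a)) (ℤₚ.+-inverseˡ (c₄ a))

  ⊗-identityʳ : ∀ a → a ⊗ ι (+ 1) ≡ a
  ⊗-identityʳ a = trans (⊗-ι a (+ 1))
    (⟨⟩-cong (ℤₚ.*-identityʳ (c₀ a)) (ℤₚ.*-identityʳ (c₁ a)) (ℤₚ.*-identityʳ (c₂ a))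
             (ℤₚ.*-identityʳ (c₃ a)) (ℤₚ.*-identityʳ (c₄ a)))

  commutativeRing : CommutativeRing 0ℓ 0ℓ
  commutativeRing = record
    { Carrier = ℤ[C₅] ; _≈_ = _≡_ ; _+_ = _⊕_ ; _*_ = _⊗_ ; -_ = ⊖_ ; 0# = ι (+ 0) ; 1# = ι (+ 1)
    ; isCommutativeRing = record
      { isRing = record
        { +-isAbelianGroup = record
          { isGroup = record
            { isMonoid = record
              { isSemigroup = record
                { isMagma = record { isEquivalence = ≡.isEquivalence ; ∙-cong = cong₂ _⊕_ }
                ; assoc = ⊕-assoc }
              ; identity = comm∧idˡ⇒id ⊕-comm ⊕-identityˡ }
            ; inverse = comm∧invˡ⇒inv ⊕-comm ⊖-inverseˡ
            ; ⁻¹-cong = cong ⊖_ }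
          ; comm = ⊕-comm }
        ; *-cong = cong₂ _⊗_
        ; *-assoc = ⊗-assoc
        ; *-identity = comm∧idʳ⇒id ⊗-comm ⊗-identityʳ
        ; distrib = ⊗-distribˡ , comm∧distrˡ⇒distrʳ ⊗-comm ⊗-distribˡ }
      ; *-comm = ⊗-comm } }

  open import Algebra.Properties.Semiring.Mult (CommutativeRing.semiring commutativeRing) using (_×_)

  ι≡×1# : ∀ n → ι (+ n) ≡ n × ι (+ 1)
  ι≡×1# zero    = refl
  ι≡×1# (suc n) = cong (ι (+ 1) ⊕_) (ι≡×1# n)

module ℤ[φ] where

  open import Data.Integer using (_+_; _*_; -_)
  open ≡ using (refl; trans; cong; cong₂)

  -- ⟨ a , b ⟩ stands for a + bφ, where φ² = φ + 1.
  record ℤ[φ] : Set where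
    constructor ⟨_,_⟩
    field c₀ c₁ : ℤ

  open ℤ[φ] public

  ⟨⟩-cong : ∀ {a₀ a₁ b₀ b₁} → a₀ ≡ b₀ → a₁ ≡ b₁ → ⟨ a₀ , a₁ ⟩ ≡ ⟨ b₀ , b₁ ⟩
  ⟨⟩-cong refl refl = refl

  ι : ℤ → ℤ[φ]
  ι c = ⟨ c , + 0 ⟩

  φ : ℤ[φ]
  φ = ⟨ + 0 , + 1 ⟩

  infixl 6 _⊕_
  infixl 7 _⊗_
  infix  8 ⊖_

  _⊕_ : ℤ[φ] → ℤ[φ] → ℤ[φ]
  ⟨ a₀ , a₁ ⟩ ⊕ ⟨ b₀ , b₁ ⟩ = ⟨ a₀ + b₀ , a₁ + b₁ ⟩

  ⊖_ : ℤ[φ] → ℤ[φ]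
  ⊖ ⟨ a₀ , a₁ ⟩ = ⟨ - a₀ , - a₁ ⟩

  _⊗_ : ℤ[φ] → ℤ[φ] → ℤ[φ]
  ⟨ a₀ , a₁ ⟩ ⊗ ⟨ b₀ , b₁ ⟩ = ⟨ a₀ * b₀ + a₁ * b₁ , a₀ * b₁ + a₁ * b₀ + a₁ * b₁ ⟩

  ⊗-comm : ∀ a b → a ⊗ b ≡ b ⊗ a
  ⊗-comm ⟨ x₀ , x₁ ⟩ ⟨ y₀ , y₁ ⟩ = ⟨⟩-cong (polynomial₀ x₀ x₁ y₀ y₁) (polynomial₁ x₀ x₁ y₀ y₁)
    where
    polynomial₀ : ∀ x₀ x₁ y₀ y₁ → x₀ * y₀ + x₁ * y₁ ≡ y₀ * x₀ + y₁ * x₁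
    polynomial₀ = solve-ℤ
    polynomial₁ : ∀ x₀ x₁ y₀ y₁ → x₀ * y₁ + x₁ * y₀ + x₁ * y₁ ≡ y₀ * x₁ + y₁ * x₀ + y₁ * x₁
    polynomial₁ = solve-ℤ

  ⊗-assoc : ∀ a b c → (a ⊗ b) ⊗ c ≡ a ⊗ (b ⊗ c)
  ⊗-assoc ⟨ x₀ , x₁ ⟩ ⟨ y₀ , y₁ ⟩ ⟨ z₀ , z₁ ⟩ =
    ⟨⟩-cong (polynomial₀ x₀ x₁ y₀ y₁ z₀ z₁) (polynomial₁ x₀ x₁ y₀ y₁ z₀ z₁)
    where
    polynomial₀ : ∀ x₀ x₁ y₀ y₁ z₀ z₁ →
      (x₀ * y₀ + x₁ * y₁) * z₀ + (x₀ * y₁ + x₁ * y₀ + x₁ * y₁) * z₁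
        ≡ x₀ * (y₀ * z₀ + y₁ * z₁) + x₁ * (y₀ * z₁ + y₁ * z₀ + y₁ * z₁)
    polynomial₀ = solve-ℤ
    polynomial₁ : ∀ x₀ x₁ y₀ y₁ z₀ z₁ →
      (x₀ * y₀ + x₁ * y₁) * z₁ + (x₀ * y₁ + x₁ * y₀ + x₁ * y₁) * z₀ + (x₀ * y₁ + x₁ * y₀ + x₁ * y₁) * z₁
        ≡ x₀ * (y₀ * z₁ + y₁ * z₀ + y₁ * z₁) + x₁ * (y₀ * z₀ + y₁ * z₁) + x₁ * (y₀ * z₁ + y₁ * z₀ + y₁ * z₁)
    polynomial₁ = solve-ℤ

  ⊗-distribˡ : ∀ a b c → a ⊗ (b ⊕ c) ≡ a ⊗ b ⊕ a ⊗ c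
  ⊗-distribˡ ⟨ x₀ , x₁ ⟩ ⟨ y₀ , y₁ ⟩ ⟨ z₀ , z₁ ⟩ =
    ⟨⟩-cong (polynomial₀ x₀ x₁ y₀ y₁ z₀ z₁) (polynomial₁ x₀ x₁ y₀ y₁ z₀ z₁)
    where
    polynomial₀ : ∀ x₀ x₁ y₀ y₁ z₀ z₁ →
      x₀ * (y₀ + z₀) + x₁ * (y₁ + z₁) ≡ x₀ * y₀ + x₁ * y₁ + (x₀ * z₀ + x₁ * z₁)
    polynomial₀ = solve-ℤ
    polynomial₁ : ∀ x₀ x₁ y₀ y₁ z₀ z₁ →
      x₀ * (y₁ + z₁) + x₁ * (y₀ + z₀) + x₁ * (y₁ + z₁) ≡ x₀ * y₁ + x₁ * y₀ + x₁ * y₁ + (x₀ * z₁ + x₁ * z₀ + x₁ * z₁)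
    polynomial₁ = solve-ℤ

  ⊗-ι : ∀ a s → a ⊗ ι s ≡ ⟨ c₀ a * s , c₁ a * s ⟩
  ⊗-ι ⟨ x₀ , x₁ ⟩ s = ⟨⟩-cong (polynomial₀ x₀ x₁ s) (polynomial₁ x₀ x₁ s)
    where
    polynomial₀ : ∀ x₀ x₁ s → x₀ * s + x₁ * (+ 0) ≡ x₀ * s
    polynomial₀ = solve-ℤ
    polynomial₁ : ∀ x₀ x₁ s → x₀ * (+ 0) + x₁ * s + x₁ * (+ 0) ≡ x₁ * s
    polynomial₁ = solve-ℤ

  ⊕-assoc : ∀ a b c → (a ⊕ b) ⊕ c ≡ a ⊕ (b ⊕ c)
  ⊕-assoc a b c = ⟨⟩-cong (ℤₚ.+-assoc (c₀ a) _ _) (ℤₚ.+-assoc (c₁ a) _ _)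

  ⊕-comm : ∀ a b → a ⊕ b ≡ b ⊕ a
  ⊕-comm a b = ⟨⟩-cong (ℤₚ.+-comm (c₀ a) _) (ℤₚ.+-comm (c₁ a) _)

  ⊕-identityˡ : ∀ a → ι (+ 0) ⊕ a ≡ a
  ⊕-identityˡ a = ⟨⟩-cong (ℤₚ.+-identityˡ (c₀ a)) (ℤₚ.+-identityˡ (c₁ a))

  ⊖-inverseˡ : ∀ a → ⊖ a ⊕ a ≡ ι (+ 0)
  ⊖-inverseˡ a = ⟨⟩-cong (ℤₚ.+-inverseˡ (c₀ a)) (ℤₚ.+-inverseˡ (c₁ a))

  ⊗-identityʳ : ∀ a → a ⊗ ι (+ 1) ≡ a
  ⊗-identityʳ a = trans (⊗-ι a (+ 1)) (⟨⟩-cong (ℤₚ.*-identityʳ (c₀ a)) (ℤₚ.*-identityʳ (c₁ a)))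

  commutativeRing : CommutativeRing 0ℓ 0ℓ
  commutativeRing = record
    { Carrier = ℤ[φ] ; _≈_ = _≡_ ; _+_ = _⊕_ ; _*_ = _⊗_ ; -_ = ⊖_ ; 0# = ι (+ 0) ; 1# = ι (+ 1)
    ; isCommutativeRing = record
      { isRing = record
        { +-isAbelianGroup = record
          { isGroup = record
            { isMonoid = record
              { isSemigroup = record
                { isMagma = record { isEquivalence = ≡.isEquivalence ; ∙-cong = cong₂ _⊕_ }
                ; assoc = ⊕-assoc }
              ; identity = comm∧idˡ⇒id ⊕-comm ⊕-identityˡ }
            ; inverse = comm∧invˡ⇒inv ⊕-comm ⊖-inverseˡ
            ; ⁻¹-cong = cong ⊖_ }
          ; comm = ⊕-comm }
        ; *-cong = cong₂ _⊗_
        ; *-assoc = ⊗-assoc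
        ; *-identity = comm∧idʳ⇒id ⊗-comm ⊗-identityʳ
        ; distrib = ⊗-distribˡ , comm∧distrˡ⇒distrʳ ⊗-comm ⊗-distribˡ }
      ; *-comm = ⊗-comm } }

  open import Algebra.Properties.Semiring.Mult (CommutativeRing.semiring commutativeRing) using (_×_)

  ι≡×1# : ∀ n → ι (+ n) ≡ n × ι (+ 1)
  ι≡×1# zero    = refl
  ι≡×1# (suc n) = cong (ι (+ 1) ⊕_) (ι≡×1# n)

  φ⊗ : ∀ a b → φ ⊗ ⟨ a , b ⟩ ≡ ⟨ b , a + b ⟩
  φ⊗ a b = ⟨⟩-cong (polynomial₀ a b) (polynomial₁ a b)
    where
    polynomial₀ : ∀ a b → + 0 * a + + 1 * b ≡ b
    polynomial₀ = solve-ℤ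
    polynomial₁ : ∀ a b → + 0 * b + + 1 * a + + 1 * b ≡ a + b
    polynomial₁ = solve-ℤ

-- 5 is a quadratic non-residue modulo p ≡ 7 (mod 10)

7+10j≡1+2[3+5j] : ∀ j → 7 ℕ.+ 10 ℕ.* j ≡ suc (2 ℕ.* (3 ℕ.+ 5 ℕ.* j))
7+10j≡1+2[3+5j] = solve-ℕ

module GaussSum {p j : ℕ} (p-prime : Prime p) (p≡7+10j : p ≡ 7 ℕ.+ 10 ℕ.* j) where

  open ℤ[C₅] using (ℤ[C₅]; ζ; ι; c₁; ⊗-ι; ⊗-comm)
  private module W/p = Quotient ℤ[C₅].commutativeRing (ι (+ p))
  open CommutativeRing W/p.quotientRing
  open import Algebra.Properties.Semiring.Exp semiring using (_^_)
  open import Algebra.Properties.Semiring.Mult semiring using (_×_)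
  open CommutativeSemiringProperties commutativeSemiring
  open Frobenius commutativeSemiring
  open import Algebra.Properties.Monoid.Sum +-monoid using (sum; sum-cong-≋)
  open import Relation.Binary.Reasoning.Setoid setoid

  gaussTerms : Vector ℤ[C₅] 4
  gaussTerms zero                   = ζ
  gaussTerms (suc zero)             = - ζ ^ 2
  gaussTerms (suc (suc zero))       = - ζ ^ 3
  gaussTerms (suc (suc (suc zero))) = ζ ^ 4

  g : ℤ[C₅]
  g = sum gaussTerms

  ι-^ : ∀ s k → ι s ^ k ≡ ι (s ℤ.^ k)
  ι-^ s zero    = ≡.refl
  ι-^ s (suc k) = ≡.trans (≡.cong (ι s *_) (ι-^ s k)) (⊗-ι (ι s) (s ℤ.^ k))

  p×≈0 : ∀ x → p × x ≈ 0#
  p×≈0 = W/p.characteristic {p} (ℤ[C₅].ι≡×1# p)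

  ^p≈^7 : ∀ x → x ^ 10 ≈ 1# → x ^ p ≈ x ^ 7
  ^p≈^7 x x^10≈1 = trans (reflexive (≡.cong (x ^_) p≡7+10j)) (^-periodic {x} {10} x^10≈1 7 j)

  g^p≈-g : g ^ p ≈ - g
  g^p≈-g = begin
    sum gaussTerms ^ p               ≈⟨ frobenius-sum p-prime p×≈0 gaussTerms ⟩
    sum (λ i → gaussTerms i ^ p)     ≈⟨ sum-cong-≋ (λ i → ^p≈^7 (gaussTerms i) (order∣10 i)) ⟩
    sum (λ i → gaussTerms i ^ 7)     ≡⟨⟩
    - g                              ∎
    where
    order∣10 : ∀ i → gaussTerms i ^ 10 ≈ 1#
    order∣10 zero                   = refl
    order∣10 (suc zero)             = refl
    order∣10 (suc (suc zero))       = refl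
    order∣10 (suc (suc (suc zero))) = refl

  -- In ℤ[C₅] only g³ = 5g holds, since g² = 5 - (1 + ζ + ζ² + ζ³ + ζ⁴).
  g^p≈5^kg : g ^ p ≈ ι (+ 5) ^ (3 ℕ.+ 5 ℕ.* j) * g
  g^p≈5^kg = trans (reflexive (≡.cong (g ^_) (≡.trans p≡7+10j (7+10j≡1+2[3+5j] j))))
                   (^-odd {g} {ι (+ 5)} refl (3 ℕ.+ 5 ℕ.* j))

  c₁-mod : ∀ {x y} → x ≈ y → c₁ x ≡ c₁ y mod p
  c₁-mod = ≋-map c₁ (≡.cong c₁) (λ _ _ → ≡.refl) (λ z → ≡.cong c₁ (⊗-ι z (+ p)))

  5^[p-1]/2≡-1 : (+ 5) ℤ.^ (3 ℕ.+ 5 ℕ.* j) ≡ ℤ.-1ℤ mod p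
  5^[p-1]/2≡-1 = ≡.subst (_≡ ℤ.-1ℤ mod p) (c₁[ιs*g] _) (c₁-mod ι[5^k]*g≈-g)
    where
    k : ℕ
    k = 3 ℕ.+ 5 ℕ.* j
    ι[5^k]*g≈-g : ι ((+ 5) ℤ.^ k) * g ≈ - g
    ι[5^k]*g≈-g = begin
      ι ((+ 5) ℤ.^ k) * g  ≡⟨ ≡.cong (_* g) (ι-^ (+ 5) k) ⟨
      ι (+ 5) ^ k * g      ≈⟨ g^p≈5^kg ⟨
      g ^ p                ≈⟨ g^p≈-g ⟩
      - g                  ∎
    c₁[ιs*g] : ∀ s → c₁ (ι s * g) ≡ s
    c₁[ιs*g] s = ≡.trans (≡.cong c₁ (≡.trans (⊗-comm (ι s) g) (⊗-ι g s))) (ℤₚ.*-identityˡ s)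

-- Fibonacci numbers modulo p

module FibonacciModPrime {p j : ℕ} (p-prime : Prime p) (p≡7+10j : p ≡ 7 ℕ.+ 10 ℕ.* j) where

  p-1 : ℕ
  p-1 = 6 ℕ.+ 10 ℕ.* j

  module ℤ[φ]/p where

    open ℤ[φ] using (ℤ[φ]; ⟨_,_⟩; φ; ι; c₀; c₁; ⊗-ι; φ⊗)
    private module Q/p = Quotient ℤ[φ].commutativeRing (ι (+ p))
    open CommutativeRing Q/p.quotientRing
    open import Algebra.Properties.Semiring.Exp semiring using (_^_)
    open import Algebra.Properties.Semiring.Mult semiring using (_×_)
    open import Algebra.Properties.Monoid.Sum +-monoid using (sum; sum-cong-≋)
    open CommutativeSemiringProperties commutativeSemiring
    open Frobenius commutativeSemiring
    open import Relation.Binary.Reasoning.Setoid setoid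

    p×≈0 : ∀ x → p × x ≈ 0#
    p×≈0 = Q/p.characteristic {p} (ℤ[φ].ι≡×1# p)

    φ^suc : ∀ n → φ ^ suc n ≡ ⟨ + F n , + F (suc n) ⟩
    φ^suc zero    = ≡.refl
    φ^suc (suc n) = ≡.trans (≡.cong (φ *_) (φ^suc n))
      (≡.trans (φ⊗ (+ F n) (+ F (suc n))) (≡.cong (λ m → ⟨ + F (suc n) , + m ⟩) (ℕₚ.+-comm (F n) (F (suc n)))))

    ι-^ : ∀ s k → ι s ^ k ≡ ι (s ℤ.^ k)
    ι-^ s zero    = ≡.refl
    ι-^ s (suc k) = ≡.trans (≡.cong (ι s *_) (ι-^ s k)) (⊗-ι (ι s) (s ℤ.^ k))

    ι-mod : ∀ {x y} → x ≡ y mod p → ι x ≈ ι y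
    ι-mod = ≋-map ι (≡.cong ι) (λ _ _ → ≡.refl) (λ z → ≡.sym (⊗-ι (ι z) (+ p)))

    c₀-mod : ∀ {x y} → x ≈ y → c₀ x ≡ c₀ y mod p
    c₀-mod = ≋-map c₀ (≡.cong c₀) (λ _ _ → ≡.refl) (λ z → ≡.cong c₀ (⊗-ι z (+ p)))

    c₁-mod : ∀ {x y} → x ≈ y → c₁ x ≡ c₁ y mod p
    c₁-mod = ≋-map c₁ (≡.cong c₁) (λ _ _ → ≡.refl) (λ z → ≡.cong c₁ (⊗-ι z (+ p)))

    √5Terms : Vector ℤ[φ] 3
    √5Terms zero             = φ
    √5Terms (suc zero)       = φ
    √5Terms (suc (suc zero)) = - 1#

    √5 : ℤ[φ]
    √5 = sum √5Terms

    φ^p : φ ^ p ≡ ⟨ + F p-1 , + F p ⟩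
    φ^p = ≡.subst (λ q → φ ^ q ≡ ⟨ + F p-1 , + F q ⟩) (≡.sym p≡7+10j) (φ^suc p-1)

    √5^p≈-√5 : √5 ^ p ≈ ι ℤ.-1ℤ * √5
    √5^p≈-√5 = begin
      √5 ^ p                           ≡⟨ ≡.cong (√5 ^_) (≡.trans p≡7+10j (7+10j≡1+2[3+5j] j)) ⟩
      √5 ^ suc (2 ℕ.* k)               ≈⟨ ^-odd {√5} {ι (+ 5)} refl k ⟩
      ι (+ 5) ^ k * √5                 ≡⟨ ≡.cong (_* √5) (ι-^ (+ 5) k) ⟩
      ι ((+ 5) ℤ.^ k) * √5             ≈⟨ *-congʳ (ι-mod (GaussSum.5^[p-1]/2≡-1 {p} {j} p-prime p≡7+10j)) ⟩
      ι ℤ.-1ℤ * √5                     ∎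
      where
      k : ℕ
      k = 3 ℕ.+ 5 ℕ.* j

    √5^p≈2φ^p-1 : √5 ^ p ≈ φ ^ p + (φ ^ p + ((- 1#) ^ 7 + 0#))
    √5^p≈2φ^p-1 = begin
      sum √5Terms ^ p                      ≈⟨ frobenius-sum p-prime p×≈0 √5Terms ⟩
      sum (λ i → √5Terms i ^ p)            ≈⟨ sum-cong-≋ reduce ⟩
      φ ^ p + (φ ^ p + ((- 1#) ^ 7 + 0#))  ∎
      where
      reduced : Vector ℤ[φ] 3
      reduced zero             = φ ^ p
      reduced (suc zero)       = φ ^ p
      reduced (suc (suc zero)) = (- 1#) ^ 7
      reduce : ∀ i → √5Terms i ^ p ≈ reduced i
      reduce zero             = refl
      reduce (suc zero)       = refl
      reduce (suc (suc zero)) =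
        trans (reflexive (≡.cong ((- 1#) ^_) p≡7+10j)) (^-periodic {x = - 1#} {10} refl 7 j)

    2φ^p-1≈-√5 : ⟨ + F p-1 , + F p ⟩ + (⟨ + F p-1 , + F p ⟩ + ((- 1#) ^ 7 + 0#)) ≈ ι ℤ.-1ℤ * √5
    2φ^p-1≈-√5 = begin
      ⟨ + F p-1 , + F p ⟩ + (⟨ + F p-1 , + F p ⟩ + ((- 1#) ^ 7 + 0#))
        ≡⟨ ≡.cong (λ t → t + (t + ((- 1#) ^ 7 + 0#))) φ^p ⟨
      φ ^ p + (φ ^ p + ((- 1#) ^ 7 + 0#))
        ≈⟨ √5^p≈2φ^p-1 ⟨
      √5 ^ p
        ≈⟨ √5^p≈-√5 ⟩
      ι ℤ.-1ℤ * √5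
        ∎

  open CommutativeRing (ℤ/ p)
  open CommutativeSemiringProperties commutativeSemiring using (*-cancelˡ-unit)
  open import Relation.Binary.Reasoning.Setoid setoid

  2⁻¹*2≡1 : + (4 ℕ.+ 5 ℕ.* j) * + 2 ≡ + 1 mod p
  2⁻¹*2≡1 = record { multiplier = + 1 ; difference =
    ≡.trans (≡.sym (ℤₚ.pos-* (4 ℕ.+ 5 ℕ.* j) 2))
    (≡.trans (≡.cong +_ (≡.trans (polynomial j) (≡.cong suc (≡.sym p≡7+10j))))
             (≡.cong (_+_ (+ 1)) (≡.sym (ℤₚ.*-identityˡ (+ p))))) }
    where
    polynomial : ∀ j → (4 ℕ.+ 5 ℕ.* j) ℕ.* 2 ≡ suc (7 ℕ.+ 10 ℕ.* j)
    polynomial = solve-ℕ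

  F[p-1]≡1 : + F p-1 ≡ + 1 mod p
  F[p-1]≡1 = *-cancelˡ-unit {+ (4 ℕ.+ 5 ℕ.* j)} {+ 2} 2⁻¹*2≡1 (begin
    + 2 * + F p-1                      ≡⟨ polynomial (+ F p-1) ⟩
    + F p-1 + (+ F p-1 + ℤ.-1ℤ) + + 1  ≈⟨ +-congʳ (ℤ[φ]/p.c₀-mod ℤ[φ]/p.2φ^p-1≈-√5) ⟩
    + 2 * + 1                          ∎)
    where
    polynomial : ∀ x → + 2 ℤ.* x ≡ x ℤ.+ (x ℤ.+ ℤ.-1ℤ) ℤ.+ + 1
    polynomial = solve-ℤ

  F[p]≡-1 : + F p ≡ ℤ.-1ℤ mod p
  F[p]≡-1 = *-cancelˡ-unit {+ (4 ℕ.+ 5 ℕ.* j)} {+ 2} 2⁻¹*2≡1 (begin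
    + 2 * + F p            ≡⟨ polynomial (+ F p) ⟩
    + F p + (+ F p + + 0)  ≈⟨ ℤ[φ]/p.c₁-mod ℤ[φ]/p.2φ^p-1≈-√5 ⟩
    + 2 * ℤ.-1ℤ            ∎)
    where
    polynomial : ∀ x → + 2 ℤ.* x ≡ x ℤ.+ (x ℤ.+ + 0)
    polynomial = solve-ℤ

  F[1+p]≡0 : + F (suc p) ≡ + 0 mod p
  F[1+p]≡0 = begin
    + F (suc p)      ≡⟨ ≡.cong +_ (≡.subst (λ q → F (suc q) ≡ F q ℕ.+ F p-1) (≡.sym p≡7+10j) ≡.refl) ⟩
    + F p + + F p-1  ≈⟨ +-cong F[p]≡-1 F[p-1]≡1 ⟩
    + 0              ∎

open import Data.Nat using (_+_; _*_; _%_; _≥_)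

F-+ : ∀ m n → F (m + suc n) ≡ F m * F n + F (suc m) * F (suc n)
F-+ m zero    = ≡.trans (≡.cong F (ℕₚ.+-comm m 1)) (polynomial (F m) (F (suc m)))
  where
  polynomial : ∀ x y → y ≡ x * 0 + y * 1
  polynomial = solve-ℕ
F-+ m (suc n) = ≡.trans (≡.cong F (ℕₚ.+-suc m (suc n)))
                (≡.trans (F-+ (suc m) n) (polynomial (F m) (F (suc m)) (F n) (F (suc n))))
  where
  polynomial : ∀ x y u v → y * u + (y + x) * v ≡ x * v + y * (v + u)
  polynomial = solve-ℕ

d'Ocagne : ∀ a n → ℤ.-1ℤ ℤ.^ n ℤ.* + F a ≡ + F (a + n) ℤ.* + F (suc n) ℤ.- + F (suc (a + n)) ℤ.* + F n
d'Ocagne a zero rewrite ℕₚ.+-identityʳ a = polynomial (+ F a) (+ F (suc a))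
  where
  polynomial : ∀ x y → ℤ.1ℤ ℤ.* x ≡ x ℤ.* + 1 ℤ.- y ℤ.* + 0
  polynomial = solve-ℤ
d'Ocagne a (suc n) rewrite ℕₚ.+-suc a n =
  ≡.trans (ℤₚ.*-assoc ℤ.-1ℤ (ℤ.-1ℤ ℤ.^ n) (+ F a))
  (≡.trans (≡.cong (ℤ._*_ ℤ.-1ℤ) (d'Ocagne a n))
           (polynomial (+ F (a + n)) (+ F (suc (a + n))) (+ F n) (+ F (suc n))))
  where
  polynomial : ∀ u v f₀ f₁ → ℤ.-1ℤ ℤ.* (u ℤ.* f₁ ℤ.- v ℤ.* f₀) ≡ v ℤ.* (f₁ ℤ.+ f₀) ℤ.- (v ℤ.+ u) ℤ.* f₁
  polynomial = solve-ℤ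

-1^m*-1^m≡1 : ∀ m → ℤ.-1ℤ ℤ.^ m ℤ.* ℤ.-1ℤ ℤ.^ m ≡ ℤ.1ℤ
-1^m*-1^m≡1 zero    = ≡.refl
-1^m*-1^m≡1 (suc m) = ≡.trans (polynomial (ℤ.-1ℤ ℤ.^ m)) (-1^m*-1^m≡1 m)
  where
  polynomial : ∀ s → ℤ.-1ℤ ℤ.* s ℤ.* (ℤ.-1ℤ ℤ.* s) ≡ s ℤ.* s
  polynomial = solve-ℤ

module FibonacciAntiperiod {q N : ℕ} (F[N]≡-1 : + F N ≡ ℤ.-1ℤ mod q) (F[1+N]≡0 : + F (suc N) ≡ + 0 mod q) where

  open CommutativeRing (ℤ/ q) using (_≈_; setoid; refl; reflexive; +-cong; +-congʳ; *-congˡ; *-congʳ; -‿cong; commutativeSemiring)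
  open CommutativeSemiringProperties commutativeSemiring using (*-cancelˡ-unit)
  open import Relation.Binary.Reasoning.Setoid setoid

  F-antiperiodic : ∀ n → + F (n + suc N) ≈ ℤ.- + F n
  F-antiperiodic n = begin
    + F (n + suc N)
      ≡⟨ ≡.cong +_ (F-+ n N) ⟩
    + (F n * F N + F (suc n) * F (suc N))
      ≡⟨ ≡.cong₂ ℤ._+_ (ℤₚ.pos-* (F n) (F N)) (ℤₚ.pos-* (F (suc n)) (F (suc N))) ⟩
    + F n ℤ.* + F N ℤ.+ + F (suc n) ℤ.* + F (suc N)
      ≈⟨ +-cong (*-congˡ {+ F n} F[N]≡-1) (*-congˡ {+ F (suc n)} F[1+N]≡0) ⟩
    + F n ℤ.* ℤ.-1ℤ ℤ.+ + F (suc n) ℤ.* + 0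
      ≡⟨ polynomial (+ F n) (+ F (suc n)) ⟩
    ℤ.- + F n
      ∎
    where
    polynomial : ∀ x y → x ℤ.* ℤ.-1ℤ ℤ.+ y ℤ.* + 0 ≡ ℤ.- x
    polynomial = solve-ℤ

  F[m[1+N]]≡0 : ∀ m → + F (m * suc N) ≈ + 0
  F[m[1+N]]≡0 zero    = refl
  F[m[1+N]]≡0 (suc m) = begin
    + F (suc N + m * suc N)  ≡⟨ ≡.cong (λ n → + F n) (ℕₚ.+-comm (suc N) (m * suc N)) ⟩
    + F (m * suc N + suc N)  ≈⟨ F-antiperiodic (m * suc N) ⟩
    ℤ.- + F (m * suc N)      ≈⟨ -‿cong (F[m[1+N]]≡0 m) ⟩
    + 0                      ∎

  F[1+m[1+N]]≡-1^m : ∀ m → + F (suc (m * suc N)) ≈ ℤ.-1ℤ ℤ.^ m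
  F[1+m[1+N]]≡-1^m zero    = refl
  F[1+m[1+N]]≡-1^m (suc m) = begin
    + F (suc (suc N + m * suc N))  ≡⟨ ≡.cong (λ n → + F n) (ℕₚ.+-comm (suc (suc N)) (m * suc N)) ⟩
    + F (m * suc N + suc (suc N))  ≡⟨ ≡.cong (λ n → + F n) (ℕₚ.+-suc (m * suc N) (suc N)) ⟩
    + F (suc (m * suc N) + suc N)  ≈⟨ F-antiperiodic (suc (m * suc N)) ⟩
    ℤ.- + F (suc (m * suc N))      ≈⟨ -‿cong (F[1+m[1+N]]≡-1^m m) ⟩
    ℤ.- ℤ.-1ℤ ℤ.^ m                ≡⟨ ℤₚ.-1*i≡-i (ℤ.-1ℤ ℤ.^ m) ⟨
    ℤ.-1ℤ ℤ.^ suc m                ∎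

  F-reflection : ∀ a b m → a + b ≡ m * suc N → ℤ.-1ℤ ℤ.^ b ℤ.* + F a ≈ ℤ.- (ℤ.-1ℤ ℤ.^ m ℤ.* + F b)
  F-reflection a b m a+b≡m[1+N] = begin
    ℤ.-1ℤ ℤ.^ b ℤ.* + F a
      ≡⟨ d'Ocagne a b ⟩
    + F (a + b) ℤ.* + F (suc b) ℤ.- + F (suc (a + b)) ℤ.* + F b
      ≡⟨ ≡.cong (λ n → + F n ℤ.* + F (suc b) ℤ.- + F (suc n) ℤ.* + F b) a+b≡m[1+N] ⟩
    + F (m * suc N) ℤ.* + F (suc b) ℤ.- + F (suc (m * suc N)) ℤ.* + F b
      ≈⟨ +-cong (*-congʳ {+ F (suc b)} (F[m[1+N]]≡0 m)) (-‿cong (*-congʳ {+ F b} (F[1+m[1+N]]≡-1^m m))) ⟩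
    + 0 ℤ.* + F (suc b) ℤ.- ℤ.-1ℤ ℤ.^ m ℤ.* + F b
      ≡⟨ polynomial (+ F (suc b)) (ℤ.-1ℤ ℤ.^ m ℤ.* + F b) ⟩
    ℤ.- (ℤ.-1ℤ ℤ.^ m ℤ.* + F b)
      ∎
    where
    polynomial : ∀ x y → + 0 ℤ.* x ℤ.- y ≡ ℤ.- y
    polynomial = solve-ℤ

  F[a]+F[b]≡0 : ∀ a b m → a + b ≡ m * suc N → ℤ.-1ℤ ℤ.^ b ≡ ℤ.-1ℤ ℤ.^ m → + F a ℤ.+ + F b ≈ + 0
  F[a]+F[b]≡0 a b m a+b≡m[1+N] -1^b≡-1^m = begin
    + F a ℤ.+ + F b      ≈⟨ +-congʳ {+ F b} F[a]≡-F[b] ⟩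
    ℤ.- + F b ℤ.+ + F b  ≡⟨ ℤₚ.+-inverseˡ (+ F b) ⟩
    + 0                  ∎
    where
    σ : ℤ
    σ = ℤ.-1ℤ ℤ.^ m
    F[a]≡-F[b] : + F a ≈ ℤ.- + F b
    F[a]≡-F[b] = *-cancelˡ-unit {σ} {σ} (reflexive (-1^m*-1^m≡1 m)) (begin
      σ ℤ.* + F a            ≡⟨ ≡.cong (ℤ._* + F a) -1^b≡-1^m ⟨
      ℤ.-1ℤ ℤ.^ b ℤ.* + F a  ≈⟨ F-reflection a b m a+b≡m[1+N] ⟩
      ℤ.- (σ ℤ.* + F b)      ≡⟨ ℤₚ.neg-distribʳ-* σ (+ F b) ⟩
      σ ℤ.* ℤ.- + F b        ∎)

5k+2≡7+10[k/2] : ∀ k → k % 2 ≡ 1 → 5 * k + 2 ≡ 7 + 10 * (k / 2)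
5k+2≡7+10[k/2] k k%2≡1 = ≡.trans (≡.cong (λ k → 5 * k + 2) k≡1+[k/2]*2) (polynomial (k / 2))
  where
  k≡1+[k/2]*2 : k ≡ 1 + k / 2 * 2
  k≡1+[k/2]*2 = ≡.trans (m≡m%n+[m/n]*n k 2) (≡.cong (_+ k / 2 * 2) k%2≡1)
  polynomial : ∀ j → 5 * (1 + j * 2) + 2 ≡ 7 + 10 * j
  polynomial = solve-ℕ

lemma3p12 : (k m : ℕ) → k % 2 ≡ 1 → Prime (5 * k + 2) → m ≥ 1 →
    (5 * k + 2) ∣ (F (5 * m * k) + F (3 * m))
lemma3p12 k m k%2≡1 p-prime _ =
  ≡0-mod⇒∣ (F[a]+F[b]≡0 (5 * m * k) (3 * m) m (5mk+3m≡m[p+1] m k) (≡.sym (ℤₚ.^-*-assoc ℤ.-1ℤ 3 m)))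
  where
  p≡7+10j : 5 * k + 2 ≡ 7 + 10 * (k / 2)
  p≡7+10j = 5k+2≡7+10[k/2] k k%2≡1
  open FibonacciModPrime {j = k / 2} p-prime p≡7+10j using (F[p]≡-1; F[1+p]≡0)
  open FibonacciAntiperiod {N = 5 * k + 2} F[p]≡-1 F[1+p]≡0 using (F[a]+F[b]≡0)
  5mk+3m≡m[p+1] : ∀ m k → 5 * m * k + 3 * m ≡ m * suc (5 * k + 2)
  5mk+3m≡m[p+1] = solve-ℕ
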